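{- Let $k,h\in\mathbb{N}$ with $k\ge1$, $h>1$. Let $A=\{a_n\}$ and $B=\{b_n\}$ be infinite sets of natural numbers (enumerated increasingly), and let $$l=\liminf_{n,m\to\infty}\frac{a_n+b_m}{n\sqrt[k]{m}}.$$ If $l<\frac{1}{\sqrt[k]{h-1}}$ then $R_k^h(A)\cap[B]^h\ne\emptyset$; and if $l=0$ then $R_k^h(A)\cap[B]^h$ is infinite for every $h>1$.
   Context: Natural numbers are positive integers; $A=\{a_n\}$ means $a_1<a_2<\ldots$. For a double sequence, $\liminf_{n,m\to\infty}c_{nm}=\lim_{j\to\infty}\left(\inf_{n,m\ge j}c_{nm}\right)$. For $A\subseteq\mathbb{N}$, $A+x=\{a+x\mid a\in A\}$. $[X]^h$ is the family of subsets of $X$ of cardinality $h$. For $h>1$, $R_k^h(A)=\{\{t_1<\ldots<t_h\}\in[\mathbb{N}]^h \mid |(A+t_1)\cap\ldots\cap(A+t_h)|\ge k\}$. -}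

module Defs where

open import Data.Nat using (ℕ; zero; suc; _+_; _*_; _∸_; _^_; _≤_; _<_)
open import Data.Fin as Fin using (Fin)
open import Data.Product using (Σ; ∃; ∃₂; _×_; _,_)
open import Data.List using (List)
open import Data.List.Relation.Unary.All using (All)
open import Relation.Binary.PropositionalEquality using (_≡_)
open import Relation.Nullary using (¬_)

-- An infinite set A = {a_1 < a_2 < ...} of positive naturals is given by its
-- increasing enumeration, shifted by one: (a i) is the paper's a_{i+1}.
IsEnumeration : (ℕ → ℕ) → Set
IsEnumeration a = (1 ≤ a 0) × (∀ i → a i < a (suc i))

_∈Enum_ : ℕ → (ℕ → ℕ) → Set
x ∈Enum a = ∃ λ i → a i ≡ x

InShift : ℕ → (ℕ → ℕ) → ℕ → Set
InShift x a t = ∃ λ i → a i + t ≡ x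

AtLeast : ℕ → (ℕ → Set) → Set
AtLeast k P = Σ (Fin k → ℕ) λ x →
  (∀ i j → x i ≡ x j → i ≡ j) × (∀ i → P (x i))

InPowB : (h : ℕ) → (ℕ → ℕ) → (Fin h → ℕ) → Set
InPowB h b t = (∀ i j → i Fin.< j → t i < t j) × (∀ i → t i ∈Enum b)

InR : (k h : ℕ) → (ℕ → ℕ) → (Fin h → ℕ) → Set
InR k h a t = AtLeast k (λ x → ∀ i → InShift x a (t i))

RBNonempty : (k h : ℕ) → (a b : ℕ → ℕ) → Set
RBNonempty k h a b = ∃ λ (t : Fin h → ℕ) → InPowB h b t × InR k h a t

-- the family R^h_k(A) ∩ [B]^h is infinite: it is not contained in any
-- finite list of h-sets (an h-set being identified with its increasing
-- enumeration Fin h → ℕ, compared pointwise)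
RBInfinite : (k h : ℕ) → (a b : ℕ → ℕ) → Set
RBInfinite k h a b = (L : List (Fin h → ℕ)) →
  ∃ λ (t : Fin h → ℕ) → InPowB h b t × InR k h a t ×
    All (λ u → ¬ (∀ i → t i ≡ u i)) L

-- "for every j there are n, m ≥ j with (a_n + b_m)/(n m^{1/k}) < r/s",
-- written (with s ≥ 1) as  (s (a_n + b_m))^k < r^k n^k m ;
-- here n = suc i, m = suc i'.
FrequentlyBelow : (k : ℕ) → (a b : ℕ → ℕ) → (r s : ℕ) → Set
FrequentlyBelow k a b r s = ∀ j → ∃₂ λ i i' → j ≤ i × j ≤ i' ×
  ((s * (a i + b i')) ^ k < (r ^ k) * ((suc i) ^ k) * suc i')

-- l < 1/(h-1)^{1/k}  ⇔  there is a rational r/s < 1/(h-1)^{1/k}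
-- (i.e. (h-1) r^k < s^k) with frequently c_{nm} < r/s
LiminfBelowRoot : (k h : ℕ) → (a b : ℕ → ℕ) → Set
LiminfBelowRoot k h a b = ∃₂ λ r s → 1 ≤ s × ((h ∸ 1) * r ^ k < s ^ k) ×
  FrequentlyBelow k a b r s

-- l = 0  ⇔  (since c_{nm} ≥ 0) for every s ≥ 1, frequently c_{nm} < 1/s
LiminfZero : (k : ℕ) → (a b : ℕ → ℕ) → Set
LiminfZero k a b = ∀ s → 1 ≤ s → FrequentlyBelow k a b 1 s

-- Fix n, m, put N = a_n + b_m and, for j ≤ m, S_j = {a_1, …, a_n} + b_j ⊆ [1, N].
-- Each S_j contains n P′ k = n(n − 1)⋯(n − k + 1) injective k-tuples, while
-- [1, N]^k has only N^k elements, so if (h − 1)·N^k < m·(n P′ k), double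
-- counting yields one k-tuple lying in h of the S_j: its entries are k common
-- points of A + b_{j₁}, …, A + b_{j_h}. Since n P′ k ≥ (n − k)^k, for large n
-- this inequality follows from (a_n + b_m)/(n·m^{1/k}) < r/s with
-- (h − 1)·r^k < s^k. When l = 0 the indices j can be confined to [J, m) with
-- 2J ≤ m: this costs a factor 2 but forces every b_j above J, so the new h-set
-- differs from any given finite list of h-sets whose least elements sum to J.

module Submission where

open import Defs
open import Data.Bool using (Bool; true; false; T; _∧_; if_then_else_)
open import Data.Bool.Properties using (T-∧; T-≡)
open import Data.Empty using (⊥-elim)
open import Data.Fin as Fin using (Fin; toℕ; fromℕ<)
open import Data.Fin.Properties using (any?; toℕ-fromℕ<)
open import Data.List using (List; []; _∷_; length; iterate)
open import Data.List.Properties using (length-iterate)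
open import Data.List.Relation.Unary.All as All using (All; []; _∷_)
open import Data.List.Relation.Unary.AllPairs using ([]; _∷_)
open import Data.List.Relation.Unary.Unique.Propositional using (Unique)
open import Data.Nat
open import Data.Nat.Combinatorics.Base using (_P′_)
open import Data.Nat.Properties
open import Data.Nat.Tactic.RingSolver using (solve-∀)
open import Algebra.Properties.CommutativeSemigroup +-commutativeSemigroup using () renaming (interchange to +-interchange)
open import Algebra.Properties.CommutativeSemigroup *-commutativeSemigroup using () renaming (interchange to *-interchange; x∙yz≈y∙xz to m*[n*o]≡n*[m*o])
open import Data.Product using (∃; _×_; _,_; proj₁; proj₂)
open import Data.Vec using (Vec; []; _∷_; lookup)
import Data.Vec.Functional as Vector
open import Function using (_∘_)
open import Function.Bundles using (Equivalence)
open import Relation.Binary.Definitions using (DecidableEquality)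
open import Relation.Binary.PropositionalEquality using (_≡_; _≢_; refl; sym; trans; cong; cong₂; subst; subst₂; module ≡-Reasoning)
open import Relation.Nullary using (¬_; yes; no)
open import Relation.Nullary.Decidable using (isYes; isNo; toWitness; fromWitness; toWitnessFalse)

private
  variable
    A B : Set

∑ : List A → (A → ℕ) → ℕ
∑ []       f = 0
∑ (x ∷ xs) f = f x + ∑ xs f

infix 5 ∑
syntax ∑ xs (λ x → e) = ∑[ x ∈ xs ] e

∑-cong : ∀ (xs : List A) {f g : A → ℕ} → (∀ x → f x ≡ g x) → ∑ xs f ≡ ∑ xs g
∑-cong []       f≡g = refl
∑-cong (x ∷ xs) f≡g = cong₂ _+_ (f≡g x) (∑-cong xs f≡g)

∑-mono : ∀ {xs : List A} {f g : A → ℕ} → All (λ x → f x ≤ g x) xs → ∑ xs f ≤ ∑ xs g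
∑-mono []           = z≤n
∑-mono (fx≤gx ∷ ps) = +-mono-≤ fx≤gx (∑-mono ps)

∑-const : ∀ (xs : List A) d → ∑[ _ ∈ xs ] d ≡ length xs * d
∑-const []       d = refl
∑-const (x ∷ xs) d = cong (d +_) (∑-const xs d)

∑-+ : ∀ (xs : List A) (f g : A → ℕ) → ∑[ x ∈ xs ] (f x + g x) ≡ ∑ xs f + ∑ xs g
∑-+ []       f g = refl
∑-+ (x ∷ xs) f g = begin
  f x + g x + ∑ xs (λ y → f y + g y)  ≡⟨ cong (f x + g x +_) (∑-+ xs f g) ⟩
  f x + g x + (∑ xs f + ∑ xs g)       ≡⟨ +-interchange (f x) (g x) (∑ xs f) (∑ xs g) ⟩
  f x + ∑ xs f + (g x + ∑ xs g)       ∎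
  where open ≡-Reasoning

∑-*ʳ : ∀ (xs : List A) (f : A → ℕ) c → ∑[ x ∈ xs ] (f x * c) ≡ ∑ xs f * c
∑-*ʳ []       f c = refl
∑-*ʳ (x ∷ xs) f c = trans (cong (f x * c +_) (∑-*ʳ xs f c)) (sym (*-distribʳ-+ c (f x) (∑ xs f)))

∑-comm : ∀ (xs : List A) (ys : List B) (f : A → B → ℕ) →
  ∑[ x ∈ xs ] ∑[ y ∈ ys ] f x y ≡ ∑[ y ∈ ys ] ∑[ x ∈ xs ] f x y
∑-comm []       ys f = sym (trans (∑-const ys 0) (*-zeroʳ (length ys)))
∑-comm (x ∷ xs) ys f =
  trans (cong (∑ ys (f x) +_) (∑-comm xs ys f)) (sym (∑-+ ys (f x) (λ y → ∑[ x ∈ xs ] f x y)))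

∑-pigeonhole : ∀ (xs : List A) (f : A → ℕ) d → length xs * d < ∑ xs f → ∃ λ x → d < f x
∑-pigeonhole []       f d ()
∑-pigeonhole (x ∷ xs) f d bound with d <? f x
... | yes d<fx = x , d<fx
... | no d≮fx  =
  ∑-pigeonhole xs f d (+-cancelˡ-< d _ _ (<-≤-trans bound (+-monoˡ-≤ (∑ xs f) (≮⇒≥ d≮fx))))

∑ⱽ : ∀ k → List A → (Vec A k → ℕ) → ℕ
∑ⱽ zero    xs f = f []
∑ⱽ (suc k) xs f = ∑[ x ∈ xs ] ∑ⱽ k xs (λ X → f (x ∷ X))

∑ⱽ-∑-comm : ∀ k (xs : List A) (ys : List B) (f : Vec A k → B → ℕ) →
  ∑ⱽ k xs (λ X → ∑ ys (f X)) ≡ ∑[ y ∈ ys ] ∑ⱽ k xs (λ X → f X y)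
∑ⱽ-∑-comm zero    xs ys f = refl
∑ⱽ-∑-comm (suc k) xs ys f =
  trans (∑-cong xs (λ x → ∑ⱽ-∑-comm k xs ys (f ∘ (x ∷_))))
        (∑-comm xs ys (λ x y → ∑ⱽ k xs (λ X → f (x ∷ X) y)))

∑ⱽ-pigeonhole : ∀ k (xs : List A) (f : Vec A k → ℕ) c →
  c * length xs ^ k < ∑ⱽ k xs f → ∃ λ X → c < f X
∑ⱽ-pigeonhole zero    xs f c bound = [] , subst (_< f []) (*-identityʳ c) bound
∑ⱽ-pigeonhole (suc k) xs f c bound =
  let (x , many) = ∑-pigeonhole xs _ (c * length xs ^ k)
                     (subst (_< ∑ⱽ (suc k) xs f) (m*[n*o]≡n*[m*o] c (length xs) _) bound)
      (X , c<f[x∷X]) = ∑ⱽ-pigeonhole k xs (f ∘ (x ∷_)) c many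
  in x ∷ X , c<f[x∷X]

𝟙 : Bool → ℕ
𝟙 b = if b then 1 else 0

𝟙-T : ∀ {b} → T b → 1 ≤ 𝟙 b
𝟙-T {true} _ = ≤-refl

count : (A → Bool) → List A → ℕ
count P xs = ∑[ x ∈ xs ] 𝟙 (P x)

T-∧⁻ : ∀ {x y} → T (x ∧ y) → T x × T y
T-∧⁻ = Equivalence.to T-∧

P′-suc : ∀ n k → n P′ suc k ≡ n * ((n ∸ 1) P′ k)
P′-suc n zero    = refl
P′-suc n (suc k) = begin
  (n ∸ suc k) * (n P′ suc k)          ≡⟨ cong ((n ∸ suc k) *_) (P′-suc n k) ⟩
  (n ∸ suc k) * (n * ((n ∸ 1) P′ k))  ≡⟨ m*[n*o]≡n*[m*o] (n ∸ suc k) n _ ⟩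
  n * ((n ∸ suc k) * ((n ∸ 1) P′ k))  ≡⟨ cong (λ m → n * (m * ((n ∸ 1) P′ k))) (sym (∸-+-assoc n 1 k)) ⟩
  n * ((n ∸ 1 ∸ k) * ((n ∸ 1) P′ k))  ∎
  where open ≡-Reasoning

[n∸k]^k≤nP′k : ∀ n k → (n ∸ k) ^ k ≤ n P′ k
[n∸k]^k≤nP′k n zero    = ≤-refl
[n∸k]^k≤nP′k n (suc k) =
  *-mono-≤ n∸1+k≤n∸k (≤-trans (^-monoˡ-≤ k n∸1+k≤n∸k) ([n∸k]^k≤nP′k n k))
  where
  n∸1+k≤n∸k : n ∸ suc k ≤ n ∸ k
  n∸1+k≤n∸k = ∸-monoʳ-≤ n (n≤1+n k)

^-mean-value-≤ : ∀ m n k → (m + n) ^ suc k ≤ m ^ suc k + suc k * n * (m + n) ^ k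
^-mean-value-≤ m n zero = ≤-reflexive (base m n)
  where
  base : ∀ m n → (m + n) * 1 ≡ m * 1 + 1 * n * 1
  base = solve-∀
^-mean-value-≤ m n (suc k) = begin
  (m + n) * (m + n) ^ suc k                        ≤⟨ *-monoʳ-≤ (m + n) (^-mean-value-≤ m n k) ⟩
  (m + n) * (m ^ suc k + suc k * n * (m + n) ^ k)  ≡⟨ expand m n (m ^ suc k) ((m + n) ^ k) (suc k) ⟩
  m ^ suc (suc k) + n * m ^ suc k + suc k * n * P  ≤⟨ +-monoˡ-≤ (suc k * n * P) (+-monoʳ-≤ _ n*mᵏ≤n*P) ⟩
  m ^ suc (suc k) + n * P + suc k * n * P          ≡⟨ collect (m ^ suc (suc k)) n P (suc k) ⟩
  m ^ suc (suc k) + suc (suc k) * n * P            ∎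
  where
  open ≤-Reasoning
  P = (m + n) ^ suc k
  n*mᵏ≤n*P : n * m ^ suc k ≤ n * P
  n*mᵏ≤n*P = *-monoʳ-≤ n (^-monoˡ-≤ (suc k) (m≤m+n m n))
  expand : ∀ m n y p s → (m + n) * (y + s * n * p) ≡ m * y + n * y + s * n * ((m + n) * p)
  expand = solve-∀
  collect : ∀ x n q s → x + n * q + s * n * q ≡ x + (1 + s) * n * q
  collect = solve-∀

c*n^k≤d*nP′k : ∀ {c d n} k → c < d → suc c * (k * k) ≤ n → c * n ^ k ≤ d * (n P′ k)
c*n^k≤d*nP′k zero c<d _ = *-monoˡ-≤ 1 (<⇒≤ c<d)
c*n^k≤d*nP′k {c} {d} {n} (suc k) c<d large = begin
  c * n ^ K      ≤⟨ *-monoʳ-≤ c nᴷ≤Y+Z ⟩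
  c * (Y + Z)    ≡⟨ *-distribˡ-+ c Y Z ⟩
  c * Y + c * Z  ≤⟨ +-monoʳ-≤ (c * Y) cZ≤Y ⟩
  c * Y + Y      ≡⟨ +-comm (c * Y) Y ⟩
  suc c * Y      ≤⟨ *-mono-≤ c<d ([n∸k]^k≤nP′k n K) ⟩
  d * (n P′ K)   ∎
  where
  open ≤-Reasoning
  K = suc k
  Y = (n ∸ K) ^ K
  Z = K * K * n ^ k
  K≤n : K ≤ n
  K≤n = ≤-trans (m≤m*n K K) (≤-trans (m≤n*m (K * K) (suc c)) large)
  nᴷ≤Y+Z : n ^ K ≤ Y + Z
  nᴷ≤Y+Z = subst (λ m → m ^ K ≤ Y + K * K * m ^ k) (m∸n+n≡m K≤n)
             (^-mean-value-≤ (n ∸ K) K k)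
  [1+c]Z≤nᴷ : suc c * Z ≤ n ^ K
  [1+c]Z≤nᴷ = ≤-trans (≤-reflexive (sym (*-assoc (suc c) (K * K) (n ^ k))))
                (*-monoˡ-≤ (n ^ k) large)
  cZ≤Y : c * Z ≤ Y
  cZ≤Y = +-cancelʳ-≤ Z (c * Z) Y
           (≤-trans (≤-reflexive (+-comm (c * Z) Z)) (≤-trans [1+c]Z≤nᴷ nᴷ≤Y+Z))

^-distrib-* : ∀ m n k → (m * n) ^ k ≡ m ^ k * n ^ k
^-distrib-* m n zero    = refl
^-distrib-* m n (suc k) = trans (cong (m * n *_) (^-distrib-* m n k)) (*-interchange m n (m ^ k) (n ^ k))

lookup-∷-injective : ∀ {k} {x : A} {X : Vec A k} → (∀ l → lookup X l ≢ x) →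
  (∀ l l′ → lookup X l ≡ lookup X l′ → l ≡ l′) →
  ∀ l l′ → lookup (x ∷ X) l ≡ lookup (x ∷ X) l′ → l ≡ l′
lookup-∷-injective x∉X inj Fin.zero    Fin.zero     _ = refl
lookup-∷-injective x∉X inj Fin.zero    (Fin.suc l′) e = ⊥-elim (x∉X l′ (sym e))
lookup-∷-injective x∉X inj (Fin.suc l) Fin.zero     e = ⊥-elim (x∉X l e)
lookup-∷-injective x∉X inj (Fin.suc l) (Fin.suc l′) e = cong Fin.suc (inj l l′ e)

module DistinctTuples {A : Set} (_≟_ : DecidableEquality A) where

  _∖_ : (A → Bool) → A → (A → Bool)
  (S ∖ x) y = S y ∧ isNo (y ≟ x)

  distinctIn : ∀ {k} → (A → Bool) → Vec A k → Bool
  distinctIn S []      = true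
  distinctIn S (x ∷ X) = S x ∧ distinctIn (S ∖ x) X

  distinctIn⇒∈ : ∀ {k} S (X : Vec A k) → T (distinctIn S X) → ∀ l → T (S (lookup X l))
  distinctIn⇒∈ S (x ∷ X) p Fin.zero    = proj₁ (T-∧⁻ p)
  distinctIn⇒∈ S (x ∷ X) p (Fin.suc l) = proj₁ (T-∧⁻ (distinctIn⇒∈ (S ∖ x) X (proj₂ (T-∧⁻ p)) l))

  distinctIn-∖⇒≢ : ∀ {k} S x (X : Vec A k) → T (distinctIn (S ∖ x) X) → ∀ l → lookup X l ≢ x
  distinctIn-∖⇒≢ S x X p l =
    toWitnessFalse {a? = lookup X l ≟ x} (proj₂ (T-∧⁻ (distinctIn⇒∈ (S ∖ x) X p l)))

  distinctIn⇒injective : ∀ {k} S (X : Vec A k) → T (distinctIn S X) →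
    ∀ l l′ → lookup X l ≡ lookup X l′ → l ≡ l′
  distinctIn⇒injective S []      _ ()
  distinctIn⇒injective S (x ∷ X) p =
    lookup-∷-injective (distinctIn-∖⇒≢ S x X tail) (distinctIn⇒injective (S ∖ x) X tail)
    where
    tail : T (distinctIn (S ∖ x) X)
    tail = proj₂ (T-∧⁻ p)

  multiplicity : A → List A → ℕ
  multiplicity x = count (λ y → isYes (y ≟ x))

  multiplicity-∉ : ∀ {x xs} → All (x ≢_) xs → multiplicity x xs ≡ 0
  multiplicity-∉ []                     = refl
  multiplicity-∉ {x} (_∷_ {y} x≢y x∉xs) with y ≟ x
  ... | yes refl = ⊥-elim (x≢y refl)
  ... | no _     = multiplicity-∉ x∉xs

  unique⇒multiplicity≤1 : ∀ x {xs} → Unique xs → multiplicity x xs ≤ 1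
  unique⇒multiplicity≤1 x []                    = z≤n
  unique⇒multiplicity≤1 x (_∷_ {y} y∉xs unique) with y ≟ x
  ... | yes refl = s≤s (≤-reflexive (multiplicity-∉ y∉xs))
  ... | no _     = unique⇒multiplicity≤1 x unique

  count-∖ : ∀ S x xs → count S xs ≤ count (S ∖ x) xs + multiplicity x xs
  count-∖ S x xs = ≤-trans (∑-mono (All.universal split xs)) (≤-reflexive (∑-+ xs _ _))
    where
    split : ∀ y → 𝟙 (S y) ≤ 𝟙 ((S ∖ x) y) + 𝟙 (isYes (y ≟ x))
    split y with S y | y ≟ x
    ... | true  | yes _ = ≤-refl
    ... | true  | no _  = ≤-refl
    ... | false | _     = z≤n

  ∸1≤count-∖ : ∀ {R} → Unique R → ∀ n S x → n ≤ count S R → n ∸ 1 ≤ count (S ∖ x) R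
  ∸1≤count-∖ {R} u n S x n≤ = m≤n+o⇒m∸n≤o n 1 (begin
    n                                   ≤⟨ n≤ ⟩
    count S R                           ≤⟨ count-∖ S x R ⟩
    count (S ∖ x) R + multiplicity x R  ≤⟨ +-monoʳ-≤ (count (S ∖ x) R) (unique⇒multiplicity≤1 x u) ⟩
    count (S ∖ x) R + 1                 ≡⟨ +-comm (count (S ∖ x) R) 1 ⟩
    1 + count (S ∖ x) R                 ∎)
    where open ≤-Reasoning

  P′≤count-distinctIn : ∀ {R} → Unique R → ∀ k n S → n ≤ count S R →
    n P′ k ≤ ∑ⱽ k R (λ X → 𝟙 (distinctIn S X))
  P′≤count-distinctIn     u zero    n S n≤ = ≤-refl
  P′≤count-distinctIn {R} u (suc k) n S n≤ = begin
    n P′ suc k                           ≡⟨ P′-suc n k ⟩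
    n * ((n ∸ 1) P′ k)                   ≤⟨ *-monoˡ-≤ ((n ∸ 1) P′ k) n≤ ⟩
    count S R * ((n ∸ 1) P′ k)           ≡⟨ ∑-*ʳ R (𝟙 ∘ S) _ ⟨
    ∑[ x ∈ R ] 𝟙 (S x) * ((n ∸ 1) P′ k)  ≤⟨ ∑-mono (All.universal by-first-entry R) ⟩
    ∑ⱽ (suc k) R (λ X → 𝟙 (distinctIn S X))  ∎
    where
    open ≤-Reasoning
    by-first-entry : ∀ x → 𝟙 (S x) * ((n ∸ 1) P′ k) ≤ ∑ⱽ k R (λ X → 𝟙 (S x ∧ distinctIn (S ∖ x) X))
    by-first-entry x with S x
    ... | false = z≤n
    ... | true  = ≤-trans (≤-reflexive (*-identityˡ _))
                    (P′≤count-distinctIn u k (n ∸ 1) (S ∖ x) (∸1≤count-∖ u n S x n≤))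

  common-distinct-tuple : ∀ {R} (Js : List B) k n c (S : B → A → Bool) → Unique R →
    All (λ j → n ≤ count (S j) R) Js → c * length R ^ k < length Js * (n P′ k) →
    ∃ λ X → c < count (λ j → distinctIn (S j) X) Js
  common-distinct-tuple {R = R} Js k n c S u large bound =
    ∑ⱽ-pigeonhole k R _ c (<-≤-trans bound double-count)
    where
    open ≤-Reasoning
    double-count : length Js * (n P′ k) ≤ ∑ⱽ k R (λ X → count (λ j → distinctIn (S j) X) Js)
    double-count = begin
      length Js * (n P′ k)                               ≡⟨ ∑-const Js _ ⟨
      ∑[ _ ∈ Js ] n P′ k                                 ≤⟨ ∑-mono (All.map (P′≤count-distinctIn u k n _) large) ⟩
      ∑[ j ∈ Js ] ∑ⱽ k R (λ X → 𝟙 (distinctIn (S j) X))  ≡⟨ ∑ⱽ-∑-comm k R Js _ ⟨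
      ∑ⱽ k R (λ X → count (λ j → distinctIn (S j) X) Js)  ∎

open DistinctTuples _≟_

Increasing : (ℕ → ℕ) → Set
Increasing v = ∀ l → v l < v (suc l)

module _ {v : ℕ → ℕ} (v↑ : Increasing v) where

  increasing-mono-≤ : ∀ {m n} → m ≤ n → v m ≤ v n
  increasing-mono-< : ∀ {m n} → m < n → v m < v n

  increasing-mono-≤ {m} {n} m≤n with m ≟ n
  ... | yes refl = ≤-refl
  ... | no m≢n   = <⇒≤ (increasing-mono-< (≤∧≢⇒< m≤n m≢n))

  increasing-mono-< {m} {suc n} (s≤s m≤n) = ≤-<-trans (increasing-mono-≤ m≤n) (v↑ n)

index<enumeration : ∀ {b} → IsEnumeration b → ∀ j → j < b j
index<enumeration (1≤b₀ , b↑) zero    = 1≤b₀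
index<enumeration (1≤b₀ , b↑) (suc j) = ≤-<-trans (index<enumeration (1≤b₀ , b↑) j) (b↑ j)

range : ℕ → ℕ → List ℕ
range lo len = iterate suc lo len

range-≥ : ∀ {m} lo len → m ≤ lo → All (m ≤_) (range lo len)
range-≥ lo zero      m≤lo = []
range-≥ lo (suc len) m≤lo = m≤lo ∷ range-≥ (suc lo) len (m≤n⇒m≤1+n m≤lo)

range-< : ∀ lo len → All (_< lo + len) (range lo len)
range-< lo zero      = []
range-< lo (suc len) =
  m<m+n lo z<s ∷ All.map (λ {x} → subst (x <_) (sym (+-suc lo len))) (range-< (suc lo) len)

range-unique : ∀ lo len → Unique (range lo len)
range-unique lo zero      = []
range-unique lo (suc len) = All.map <⇒≢ (range-≥ (suc lo) len ≤-refl) ∷ range-unique (suc lo) len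

increasing-≤-count : ∀ {v} (P : ℕ → Bool) → Increasing v → ∀ lo len i → lo ≤ v 0 → v i < lo + len →
  (∀ l → l ≤ i → T (P (v l))) → suc i ≤ count P (range lo len)
increasing-≤-count P v↑ lo zero i lo≤v₀ vᵢ< _ =
  ⊥-elim (<⇒≱ vᵢ< (≤-trans (≤-reflexive (+-identityʳ lo)) (≤-trans lo≤v₀ (increasing-mono-≤ v↑ z≤n))))
increasing-≤-count {v} P v↑ lo (suc len) i lo≤v₀ vᵢ< Pv with v 0 ≟ lo
... | no v₀≢lo =
  ≤-trans (increasing-≤-count P v↑ (suc lo) len i (≤∧≢⇒< lo≤v₀ (v₀≢lo ∘ sym))
             (subst (v i <_) (+-suc lo len) vᵢ<) Pv)
          (m≤n+m _ _)
increasing-≤-count {v} P v↑ _ (suc len) zero    _ _   Pv | yes refl =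
  ≤-trans (𝟙-T (Pv 0 z≤n)) (m≤m+n _ _)
increasing-≤-count {v} P v↑ _ (suc len) (suc i) _ vᵢ< Pv | yes refl =
  +-mono-≤ (𝟙-T (Pv 0 z≤n))
    (increasing-≤-count P (v↑ ∘ suc) (suc (v 0)) len i (v↑ 0)
       (subst (v (suc i) <_) (+-suc (v 0) len) vᵢ<) (λ l l≤i → Pv (suc l) (s≤s l≤i)))

∷-increasing : ∀ {h} x (t : Fin h → ℕ) → (∀ l → x < t l) → (∀ l l′ → l Fin.< l′ → t l < t l′) →
  ∀ l l′ → l Fin.< l′ → (x Vector.∷ t) l < (x Vector.∷ t) l′
∷-increasing x t x<t t↑ Fin.zero    (Fin.suc l′) _          = x<t l′
∷-increasing x t x<t t↑ (Fin.suc l) (Fin.suc l′) (s≤s l<l′) = t↑ l l′ l<l′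

choose-increasing : ∀ (P : ℕ → Bool) lo len h → h ≤ count P (range lo len) →
  ∃ λ (t : Fin h → ℕ) → (∀ l l′ → l Fin.< l′ → t l < t l′) × (∀ l → lo ≤ t l × T (P (t l)))
choose-increasing P lo len       zero    _ = (λ ()) , (λ ()) , (λ ())
choose-increasing P lo zero      (suc h) ()
choose-increasing P lo (suc len) (suc h) h≤ with P lo in Plo
... | false =
  let (t , t↑ , t∈) = choose-increasing P (suc lo) len (suc h) h≤
  in t , t↑ , λ l → <⇒≤ (proj₁ (t∈ l)) , proj₂ (t∈ l)
... | true =
  let (t , t↑ , t∈) = choose-increasing P (suc lo) len h (s≤s⁻¹ h≤)
  in lo Vector.∷ t , ∷-increasing lo t (proj₁ ∘ t∈) t↑ ,
     λ { Fin.zero    → ≤-refl , Equivalence.from T-≡ Plo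
       ; (Fin.suc l) → <⇒≤ (proj₁ (t∈ l)) , proj₂ (t∈ l) }

inPrefixShift : (ℕ → ℕ) → ℕ → ℕ → ℕ → Bool
inPrefixShift a i t y = isYes (any? λ (l : Fin (suc i)) → a (toℕ l) + t ≟ y)

inPrefixShift-sound : ∀ a i t {y} → T (inPrefixShift a i t y) → InShift y a t
inPrefixShift-sound a i t p = let (l , aₗ+t≡y) = toWitness p in toℕ l , aₗ+t≡y

inPrefixShift-complete : ∀ a i t {l} → l ≤ i → T (inPrefixShift a i t (a l + t))
inPrefixShift-complete a i t l≤i =
  fromWitness (fromℕ< (s≤s l≤i) , cong (λ m → a m + t) (toℕ-fromℕ< (s≤s l≤i)))

inPrefixShift-count : ∀ {a} → IsEnumeration a → ∀ i t N → a i + t ≤ N →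
  suc i ≤ count (inPrefixShift a i t) (range 1 N)
inPrefixShift-count {a} (1≤a₀ , a↑) i t N aᵢ+t≤N =
  increasing-≤-count {v = λ l → a l + t} (inPrefixShift a i t) (λ l → +-monoˡ-< t (a↑ l)) 1 N i
    (≤-trans 1≤a₀ (m≤m+n _ t)) (s≤s aᵢ+t≤N) (λ l → inPrefixShift-complete a i t)

distinctIn-shifts⇒InR : ∀ {k h} a i (t : Fin (suc h) → ℕ) (X : Vec ℕ k) →
  (∀ l → T (distinctIn (inPrefixShift a i (t l)) X)) → InR k (suc h) a t
distinctIn-shifts⇒InR a i t X X∈ =
  lookup X , distinctIn⇒injective _ X (X∈ Fin.zero) ,
  λ l′ l → inPrefixShift-sound a i (t l) (distinctIn⇒∈ _ X (X∈ l) l′)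

RB-witness-from-window : ∀ k c {a b} → IsEnumeration a → IsEnumeration b →
  ∀ i i′ J len → J + len ≤ suc i′ → c * (a i + b i′) ^ k < len * (suc i P′ k) →
  ∃ λ t → InPowB (suc c) b t × InR k (suc c) a t × (∀ l → b J ≤ t l)
RB-witness-from-window k c {a} {b} ea (_ , b↑) i i′ J len window bound =
  let (X , c<count) = common-distinct-tuple (range J len) k (suc i) c S (range-unique 1 N)
                        large bound′
      (j , j↑ , j≥×X∈) = choose-increasing (λ j → distinctIn (S j) X) J len (suc c) c<count
  in b ∘ j , ((λ l l′ l<l′ → increasing-mono-< b↑ (j↑ l l′ l<l′)) , λ l → j l , refl) ,
     distinctIn-shifts⇒InR a i (b ∘ j) X (proj₂ ∘ j≥×X∈) ,
     λ l → increasing-mono-≤ b↑ (proj₁ (j≥×X∈ l))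
  where
  N = a i + b i′
  S : ℕ → ℕ → Bool
  S j = inPrefixShift a i (b j)
  large : All (λ j → suc i ≤ count (S j) (range 1 N)) (range J len)
  large = All.map (λ {j} j<J+len → inPrefixShift-count ea i (b j) N
            (+-monoʳ-≤ (a i) (increasing-mono-≤ b↑ (m<1+n⇒m≤n (<-≤-trans j<J+len window)))))
          (range-< J len)
  bound′ : c * length (range 1 N) ^ k < length (range J len) * (suc i P′ k)
  bound′ = subst₂ (λ m n → c * m ^ k < n * (suc i P′ k))
             (sym (length-iterate suc 1 N)) (sym (length-iterate suc J len)) bound

frequently-below⇒bound : ∀ {c r s n m} k N .{{_ : NonZero c}} → c * r ^ k < s ^ k →
  suc (c * r ^ k) * (k * k) ≤ n → (s * N) ^ k < r ^ k * n ^ k * m → c * N ^ k < m * (n P′ k)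
frequently-below⇒bound {c} {r} {s} {n} {m} k N crᵏ<sᵏ large below =
  *-cancelˡ-< (s ^ k) _ _ (begin-strict
    s ^ k * (c * N ^ k)      ≡⟨ m*[n*o]≡n*[m*o] (s ^ k) c (N ^ k) ⟩
    c * (s ^ k * N ^ k)      ≡⟨ cong (c *_) (^-distrib-* s N k) ⟨
    c * (s * N) ^ k          <⟨ *-monoʳ-< c below ⟩
    c * (r ^ k * n ^ k * m)  ≡⟨ *-assoc c (r ^ k * n ^ k) m ⟨
    c * (r ^ k * n ^ k) * m  ≡⟨ cong (_* m) (*-assoc c (r ^ k) (n ^ k)) ⟨
    c * r ^ k * n ^ k * m    ≤⟨ *-monoˡ-≤ m (c*n^k≤d*nP′k k crᵏ<sᵏ large) ⟩
    s ^ k * (n P′ k) * m     ≡⟨ *-assoc (s ^ k) (n P′ k) m ⟩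
    s ^ k * ((n P′ k) * m)   ≡⟨ cong (s ^ k *_) (*-comm (n P′ k) m) ⟩
    s ^ k * (m * (n P′ k))   ∎)
  where open ≤-Reasoning

2*x<m*p⇒x<[m∸J]*p : ∀ {x p} m J → 2 * J ≤ m → 2 * x < m * p → x < (m ∸ J) * p
2*x<m*p⇒x<[m∸J]*p {x} {p} m J 2J≤m 2x<mp = *-cancelˡ-< 2 x _ (begin-strict
  2 * x            <⟨ 2x<mp ⟩
  m * p            ≤⟨ *-monoˡ-≤ p m≤2[m∸J] ⟩
  2 * (m ∸ J) * p  ≡⟨ *-assoc 2 (m ∸ J) p ⟩
  2 * ((m ∸ J) * p)  ∎)
  where
  open ≤-Reasoning
  J≤m∸J : J ≤ m ∸ J
  J≤m∸J = m+n≤o⇒m≤o∸n J (subst (_≤ m) (cong (J +_) (+-identityʳ J)) 2J≤m)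
  m≤2[m∸J] : m ≤ 2 * (m ∸ J)
  m≤2[m∸J] = begin
    m                  ≡⟨ m+[n∸m]≡n (m+n≤o⇒m≤o J 2J≤m) ⟨
    J + (m ∸ J)        ≤⟨ +-monoˡ-≤ (m ∸ J) J≤m∸J ⟩
    (m ∸ J) + (m ∸ J)  ≡⟨ cong ((m ∸ J) +_) (+-identityʳ (m ∸ J)) ⟨
    2 * (m ∸ J)        ∎

∑<⇒all-≢ : ∀ {h} (t : Fin h → ℕ) z (L : List (Fin h → ℕ)) → ∑[ u ∈ L ] u z < t z →
  All (λ u → ¬ (∀ i → t i ≡ u i)) L
∑<⇒all-≢ t z []      _     = []
∑<⇒all-≢ t z (u ∷ L) bound =
  (λ t≡u → <-irrefl (sym (t≡u z)) (≤-<-trans (m≤m+n (u z) _) bound)) ∷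
  ∑<⇒all-≢ t z L (≤-<-trans (m≤n+m _ (u z)) bound)

liminfBelowRoot⇒RBNonempty : ∀ k h₁ .{{_ : NonZero h₁}} {a b} → IsEnumeration a → IsEnumeration b →
  LiminfBelowRoot k (suc h₁) a b → RBNonempty k (suc h₁) a b
liminfBelowRoot⇒RBNonempty k h₁ {a} {b} ea eb (r , s , _ , h₁rᵏ<sᵏ , often) =
  let (i , i′ , i≥ , _ , below) = often (suc (h₁ * r ^ k) * (k * k))
      (t , t∈B , t∈R , _) = RB-witness-from-window k h₁ ea eb i i′ 0 (suc i′) ≤-refl
                              (frequently-below⇒bound k (a i + b i′) h₁rᵏ<sᵏ (m≤n⇒m≤1+n i≥) below)
  in t , t∈B , t∈R

liminfZero⇒RBInfinite : ∀ k h₁ .{{_ : NonZero h₁}} {a b} → IsEnumeration a → IsEnumeration b →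
  LiminfZero (suc k) a b → RBInfinite (suc k) (suc h₁) a b
liminfZero⇒RBInfinite k h₁ {a} {b} ea eb zero-liminf L =
  let (i , i′ , i≥ , i′≥ , below) = zero-liminf (suc c) (s≤s z≤n) (n₀ ⊔ 2 * J)
      (t , t∈B , t∈R , t≥) = RB-witness-from-window K h₁ ea eb i i′ J (suc i′ ∸ J)
                               (window i′≥) (window-bound i≥ i′≥ below)
  in t , t∈B , t∈R , ∑<⇒all-≢ t Fin.zero L (<-≤-trans (index<enumeration eb J) (t≥ Fin.zero))
  where
  K = suc k
  c = 2 * h₁
  J = ∑[ u ∈ L ] u Fin.zero
  n₀ = suc (c * 1 ^ K) * (K * K)
  c1ᴷ<[1+c]ᴷ : c * 1 ^ K < suc c ^ K
  c1ᴷ<[1+c]ᴷ = begin-strict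
    c * 1 ^ K  ≡⟨ cong (c *_) (^-zeroˡ K) ⟩
    c * 1      ≡⟨ *-identityʳ c ⟩
    c          <⟨ n<1+n c ⟩
    suc c      ≡⟨ *-identityʳ (suc c) ⟨
    suc c * 1  ≤⟨ *-monoʳ-≤ (suc c) (m^n>0 (suc c) k) ⟩
    suc c ^ K  ∎
    where open ≤-Reasoning
  2J≤ : ∀ {i′} → n₀ ⊔ 2 * J ≤ i′ → 2 * J ≤ suc i′
  2J≤ i′≥ = m≤n⇒m≤1+n (m⊔n≤o⇒n≤o n₀ (2 * J) i′≥)
  window : ∀ {i′} → n₀ ⊔ 2 * J ≤ i′ → J + (suc i′ ∸ J) ≤ suc i′
  window i′≥ = ≤-reflexive (m+[n∸m]≡n (m+n≤o⇒m≤o J (2J≤ i′≥)))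
  window-bound : ∀ {i i′} → n₀ ⊔ 2 * J ≤ i → n₀ ⊔ 2 * J ≤ i′ →
    (suc c * (a i + b i′)) ^ K < 1 ^ K * suc i ^ K * suc i′ →
    h₁ * (a i + b i′) ^ K < (suc i′ ∸ J) * (suc i P′ K)
  window-bound {i} {i′} i≥ i′≥ below =
    2*x<m*p⇒x<[m∸J]*p (suc i′) J (2J≤ i′≥)
      (subst (_< suc i′ * (suc i P′ K)) (*-assoc 2 h₁ ((a i + b i′) ^ K))
        (frequently-below⇒bound K (a i + b i′) {{m*n≢0 2 h₁}} c1ᴷ<[1+c]ᴷ
          (m≤n⇒m≤1+n (m⊔n≤o⇒m≤o n₀ (2 * J) i≥)) below))

theorem2p3 : (k h : ℕ) → 1 ≤ k → 1 < h →
    (a b : ℕ → ℕ) → IsEnumeration a → IsEnumeration b →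
    (LiminfBelowRoot k h a b → RBNonempty k h a b) ×
    (LiminfZero k a b → RBInfinite k h a b)
theorem2p3 (suc k) (suc h₁@(suc _)) (s≤s z≤n) (s≤s (s≤s z≤n)) a b ea eb =
  liminfBelowRoot⇒RBNonempty (suc k) h₁ ea eb , liminfZero⇒RBInfinite k h₁ ea eb
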